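{- Let $S[1\mathinner{.\,.} n]$, over alphabet $[1\mathinner{.\,.}\sigma]$, have measure $\delta=\delta(S)$. Then the block tree of $S$ with parameters $\tau$ and $s$ has size $O\!\left(s+\delta\tau\log_\tau\frac{n\log\sigma}{s\log n}\right)$ words and height $h=O\!\left(\log_\tau\frac{n\log\sigma}{s\log n}\right)$.
   Context: $d_k(S)$ is the number of distinct length-$k$ substrings of $S$ and $\delta(S)=\max\{d_k(S)/k : k\in[1\mathinner{.\,.} n]\}$. Block tree with integer parameters $\tau\ge2$ and $s\ge1$ (assume $n=s\cdot\tau^t$ for an integer $t$, padding $S$ at the end otherwise): the root level divides $S$ into $s$ consecutive blocks of equal length. At a level where blocks have length $\tau^k$, the blocks present are classified: whenever two blocks $B',B''$ that are adjacent in $S$ are such that the text position of $B'\cdot B''$ is the leftmost occurrence in $S$ of the string $B'\cdot B''$, both $B'$ and $B''$ are marked; remaining blocks are unmarked. Each unmarked block $B$ is replaced by a pointer to the pair of adjacent (marked) blocks of that level containing the leftmost occurrence of $B$ together with the offset of that occurrence. Each marked block is divided into $\tau$ equal-length sub-blocks, which form the blocks of the next level (its children), processed recursively. Recursion stops at the level where block length falls below $\log_\sigma n$; these leaf blocks store their content explicitly in $O(\log n)$ bits. Each block uses $O(1)$ words; the size is the total number of words, and the height is the number of levels. Words have $\Theta(\log n)$ bits. -}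

module Defs where

open import Data.Bool using (Bool; true; false; if_then_else_; _∧_; _∨_; not)
open import Data.Nat using (ℕ; zero; suc; _+_; _*_; _∸_; _^_; _≤ᵇ_; _<ᵇ_; _≡ᵇ_; _⊔_)
open import Data.Nat.Logarithm using (⌈log₂_⌉)
open import Data.Fin using (Fin)
import Data.Fin as F
open import Data.List using (List; []; _∷_; length; take; drop; map; upTo; concatMap; foldr; deduplicate)
open import Data.Bool.ListAction using (any; all)
open import Data.List.Properties using (≡-dec)
open import Data.Integer using (+_)
open import Data.Rational using (ℚ; _/_; 0ℚ)
import Data.Rational as Q
open import Relation.Nullary.Decidable using (⌊_⌋)

-- Strings over the alphabet [1..σ] are lists over Fin σ; positions are 0-based.
Str : ℕ → Set
Str σ = List (Fin σ)

sub : ∀ {σ} → Str σ → ℕ → ℕ → Str σ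
sub S p m = take m (drop p S)

eqStr? : ∀ {σ} (u v : Str σ) → Bool
eqStr? u v = ⌊ ≡-dec F._≟_ u v ⌋

dist : ∀ {σ} → ℕ → Str σ → ℕ
dist k S = length (deduplicate (≡-dec F._≟_)
                     (map (λ p → sub S p k) (upTo (suc (length S) ∸ k))))

δ : ∀ {σ} → Str σ → ℚ
δ S = foldr Q._⊔_ 0ℚ (map (λ j → (+ dist (suc j) S) / suc j) (upTo (length S)))

leftmost : ∀ {σ} → Str σ → ℕ → ℕ → Bool
leftmost S p m = all (λ q → not (eqStr? (sub S q m) (sub S p m))) (upTo p)

filterᵇ : {A : Set} → (A → Bool) → List A → List A
filterᵇ f [] = []
filterᵇ f (x ∷ xs) = if f x then x ∷ filterᵇ f xs else filterᵇ f xs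

memᵇ : ℕ → List ℕ → Bool
memᵇ x xs = any (λ y → y ≡ᵇ x) xs

-- A level is given by the list of starting positions of its blocks,
-- all of length b.
marked : ∀ {σ} → Str σ → (b : ℕ) → List ℕ → List ℕ
marked S b bs = filterᵇ isMarked bs
  where
  isMarked : ℕ → Bool
  isMarked p =
    (memᵇ (p + b) bs ∧ leftmost S p (b + b))
    ∨ ((b ≤ᵇ p) ∧ memᵇ (p ∸ b) bs ∧ leftmost S (p ∸ b) (b + b))

children : ∀ {σ} → Str σ → (τ k : ℕ) → List ℕ → List ℕ
children S τ k bs =
  concatMap (λ p → map (λ i → p + i * τ ^ k) (upTo τ)) (marked S (τ ^ suc k) bs)

-- The level with block length τ^k is a leaf level iff τ^k < log_σ n,
-- i.e. σ^(τ^k) < n (or k = 0: blocks of length 1 cannot be subdivided).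
isLeafLevel : (σ n τ k : ℕ) → Bool
isLeafLevel σ n τ k = σ ^ (τ ^ k) <ᵇ n

record Counts : Set where
  constructor counts
  field
    size   : ℕ   -- total number of blocks (each block uses O(1) words)
    height : ℕ

-- process the level with block length τ^k and block starts bs, and everything below
-- (a level with no blocks does not exist, so contributes no height)
levels : ∀ {σ} → Str σ → (τ k : ℕ) → List ℕ → Counts
levels {σ} S τ k [] = counts 0 0
levels {σ} S τ zero bs@(_ ∷ _) = counts (length bs) 1
levels {σ} S τ (suc k) bs@(_ ∷ _) =
  if isLeafLevel σ (length S) τ (suc k)
  then counts (length bs) 1
  else (λ c → counts (length bs + Counts.size c) (suc (Counts.height c)))
         (levels S τ k (children S τ k bs))

-- block tree of S with parameters τ, s, when |S| = s·τ^t: root level has the s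
-- blocks of length τ^t
blockTree : ∀ {σ} → Str σ → (τ s t : ℕ) → Counts
blockTree S τ s t = levels S τ t (map (λ i → i * τ ^ t) (upTo s))

btSize : ∀ {σ} → Str σ → (τ s t : ℕ) → ℕ
btSize S τ s t = Counts.size (blockTree S τ s t)

btHeight : ∀ {σ} → Str σ → (τ s t : ℕ) → ℕ
btHeight S τ s t = Counts.height (blockTree S τ s t)

-- Integer version of 1 + log_τ ( n log σ / (s log n) ):
-- 1 + (least j with n·⌈log₂σ⌉ ≤ τ^j · s · max(1,⌈log₂ n⌉)).
logSearch : (a c τ : ℕ) → (fuel j : ℕ) → ℕ
logSearch a c τ zero j = j
logSearch a c τ (suc f) j = if a ≤ᵇ τ ^ j * c then j else logSearch a c τ f (suc j)

logTerm : (n σ s τ : ℕ) → ℕ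
logTerm n σ s τ = suc (logSearch a c τ (suc a) 0)
  where
  a = n * ⌈log₂ σ ⌉
  c = s * (⌈log₂ n ⌉ ⊔ 1)

ℕtoℚ : ℕ → ℚ
ℕtoℚ m = + m / 1

module Submission where

open import Defs
open import Data.Bool using (Bool; true; false; T; not; _∧_; _∨_)
open import Data.Bool.Properties using (T-∧; T-∨)
open import Data.Nat using (ℕ; zero; suc; _+_; _*_; _∸_; _^_; _⊓_; _⊔_; _/_; _≤_; _<_; _≥_; z≤n; s≤s; s≤s⁻¹; NonZero; >-nonZero; >-nonZero⁻¹; _≤ᵇ_; ⌈_/2⌉; ⌊_/2⌋)
open import Data.Nat.Logarithm using (⌈log₂_⌉; ⌈log₂⌉-mono-≤; ⌈log₂2^n⌉≡n)
open import Data.Nat.Logarithm.Core using (⌈log2⌉)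
open import Data.Nat.Induction using (<-wellFounded)
open import Induction.WellFounded using (Acc; acc)
open import Data.Nat.Divisibility using (_∣_; divides; ∣-trans; ∣m∣n⇒∣m+n; n∣m*n)
open import Data.Nat.DivMod using (m*n/n≡m; /-monoˡ-≤; n/1≡n; m/n*n≤m)
open import Data.Nat.Tactic.RingSolver using (solve-∀)
open import Data.Nat.Properties
open import Data.List using (List; []; _∷_; length; foldr; map; upTo; take; drop; _++_; concatMap)
open import Data.List.Properties using (length-++; length-upTo; take-drop; take-take; drop-drop; length-map; ≡-dec)
open import Data.List.Relation.Unary.All as All using (All; []; _∷_)
import Data.List.Relation.Unary.All.Properties as All
open import Data.List.Relation.Unary.Any using (here; there)
open import Data.List.Relation.Unary.AllPairs as AllPairs using (AllPairs; []; _∷_)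
import Data.List.Relation.Unary.AllPairs.Properties as AllPairs
open import Data.List.Relation.Unary.Unique.Propositional using (Unique)
open import Data.List.Relation.Binary.Subset.Propositional using (_⊆_)
open import Data.List.Membership.Propositional using (_∈_)
open import Data.List.Membership.Propositional.Properties
  using (∈-∃++; ∈-++⁻; ∈-++⁺ˡ; ∈-++⁺ʳ; ∈-map⁺; ∈-map⁻; ∈-upTo⁺; ∈-upTo⁻; ∈-deduplicate⁺)
open import Data.Product using (Σ; _×_; _,_; proj₂)
open import Data.Sum using (_⊎_; inj₁; inj₂)
open import Data.Empty using (⊥-elim)
open import Function using (_∘_; Equivalence)
open import Relation.Nullary using (¬_; yes; no)
open import Relation.Nullary.Decidable using (fromWitness; toWitness)
open import Relation.Binary.PropositionalEquality
import Data.Fin as Fin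
import Data.Integer as ℤ
import Data.Integer.Properties as ℤₚ
open import Data.Rational using (ℚ; toℚᵘ)
import Data.Rational as Q
import Data.Rational.Properties as Qₚ
open import Data.Rational.Unnormalised as U using (ℚᵘ; mkℚᵘ)
import Data.Rational.Unnormalised.Properties as Uₚ

-- The level of block length τ^K is not a leaf level only if n ≤ σ^(τ^K), i.e.
-- log n ≤ τ^K·log σ.  With n·log σ ≤ τ^j·s·log n (j is the exponent found by logTerm)
-- and n = s·τ^t this forces K ≥ t − j, so at most j + 2 ≤ 2·logTerm levels exist.
--
-- Let Δ(S) = max_k ⌊4·d_k(S)/k⌋ ≤ 4·δ(S).  On a level of block length b, a marked
-- block m away from the ends of S is half of a leftmost occurrence of a pair of blocks;
-- the b windows of length 4b starting at m−2b, …, m−b−1 contain it, hence are leftmost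
-- occurrences too, and windows of distinct blocks are disjoint.  So at most
-- d_{4b}(S)/b ≤ Δ(S) blocks, plus 4 near the ends, are marked; every level has at most
-- 2·Δ(S)·τ children, the tree at most s + 2·logTerm·2·Δ(S)·τ blocks, and clearing the
-- denominator of δ(S) gives the theorem with C = 16.

unique-⊆-length : {A : Set} {xs ys : List A} → Unique xs → xs ⊆ ys → length xs ≤ length ys
unique-⊆-length {xs = []} _ _ = z≤n
unique-⊆-length {xs = x ∷ xs} (x∉xs ∷ xs!) xs⊆ys with ∈-∃++ (xs⊆ys (here refl))
... | us , vs , refl = begin
    suc (length xs)          ≤⟨ s≤s (unique-⊆-length xs! xs⊆us++vs) ⟩
    suc (length (us ++ vs))  ≡⟨ cong suc (length-++ us) ⟩
    suc (length us + length vs) ≡⟨ +-suc (length us) (length vs) ⟨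
    length us + length (x ∷ vs) ≡⟨ length-++ us ⟨
    length (us ++ x ∷ vs)    ∎
  where
  open ≤-Reasoning
  xs⊆us++vs : xs ⊆ us ++ vs
  xs⊆us++vs {y} y∈xs with ∈-++⁻ us (xs⊆ys (there y∈xs))
  ... | inj₁ y∈us         = ∈-++⁺ˡ y∈us
  ... | inj₂ (here refl)  = ⊥-elim (All.lookup x∉xs y∈xs refl)
  ... | inj₂ (there y∈vs) = ∈-++⁺ʳ us y∈vs

upTo-sorted : ∀ n → AllPairs _<_ (upTo n)
upTo-sorted n = AllPairs.applyUpTo⁺₁ (λ i → i) n (λ i<j _ → i<j)

AllPairs-upgrade : {A : Set} {P : A → Set} {R Q : A → A → Set} →
  (∀ {x y} → P x → P y → R x y → Q x y) → {xs : List A} → AllPairs R xs → All P xs → AllPairs Q xs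
AllPairs-upgrade upgrade [] [] = []
AllPairs-upgrade upgrade (Rxs ∷ Rs) (Px ∷ Ps) =
  All.zipWith (λ (Rxy , Py) → upgrade Px Py Rxy) (Rxs , Ps) ∷ AllPairs-upgrade upgrade Rs Ps

concatMap-sorted : {P : ℕ → Set} (f : ℕ → List ℕ) {ms : List ℕ} →
  AllPairs _<_ ms → All P ms →
  (∀ {m} → P m → AllPairs _<_ (f m)) →
  (∀ {m m'} → P m → P m' → m < m' → All (λ x → All (x <_) (f m')) (f m)) →
  AllPairs _<_ (concatMap f ms)
concatMap-sorted f ms-sorted Pms f-sorted f-separated =
  AllPairs.concat⁺ (All.map⁺ (All.map f-sorted Pms))
                   (AllPairs.map⁺ (AllPairs-upgrade f-separated ms-sorted Pms))

∈-filterᵇ⁻ : {A : Set} (f : A → Bool) (xs : List A) → ∀ {x} → x ∈ filterᵇ f xs → x ∈ xs × T (f x)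
∈-filterᵇ⁻ f (y ∷ ys) x∈ with f y in fy
∈-filterᵇ⁻ f (y ∷ ys) (here refl) | true = here refl , subst T (sym fy) _
∈-filterᵇ⁻ f (y ∷ ys) (there x∈)  | true = let (x∈ys , fx) = ∈-filterᵇ⁻ f ys x∈ in there x∈ys , fx
∈-filterᵇ⁻ f (y ∷ ys) x∈          | false = let (x∈ys , fx) = ∈-filterᵇ⁻ f ys x∈ in there x∈ys , fx

All-filterᵇ : {A : Set} {P : A → Set} (f : A → Bool) {xs : List A} → All P xs → All P (filterᵇ f xs)
All-filterᵇ f [] = []
All-filterᵇ f {y ∷ _} (Py ∷ Pys) with f y
... | true  = Py ∷ All-filterᵇ f Pys
... | false = All-filterᵇ f Pys

AllPairs-filterᵇ : {A : Set} {R : A → A → Set} (f : A → Bool) {xs : List A} →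
  AllPairs R xs → AllPairs R (filterᵇ f xs)
AllPairs-filterᵇ f [] = []
AllPairs-filterᵇ f {y ∷ _} (Rys ∷ Rs) with f y
... | true  = All-filterᵇ f Rys ∷ AllPairs-filterᵇ f Rs
... | false = AllPairs-filterᵇ f Rs

length-filterᵇ-split : {A : Set} (f g : A → Bool) (xs : List A) →
  length (filterᵇ f xs) ≤ length (filterᵇ (λ x → f x ∧ g x) xs) + length (filterᵇ (not ∘ g) xs)
length-filterᵇ-split f g [] = z≤n
length-filterᵇ-split f g (y ∷ ys) with f y | g y
... | true  | true  = s≤s (length-filterᵇ-split f g ys)
... | true  | false = ≤-trans (s≤s (length-filterᵇ-split f g ys)) (≤-reflexive (sym (+-suc _ _)))
... | false | true  = length-filterᵇ-split f g ys
... | false | false = ≤-trans (length-filterᵇ-split f g ys) (+-monoʳ-≤ _ (n≤1+n _))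

sub-sub : ∀ {σ} (S : Str σ) q o r ℓ → ℓ ≤ r → sub (sub S q (o + r)) o ℓ ≡ sub S (q + o) ℓ
sub-sub S q o r ℓ ℓ≤r = begin
    take ℓ (drop o (take (o + r) (drop q S)))  ≡⟨ cong (take ℓ) (take-drop r o (drop q S)) ⟨
    take ℓ (take r (drop o (drop q S)))        ≡⟨ take-take ℓ r _ ⟩
    take (ℓ ⊓ r) (drop o (drop q S))           ≡⟨ cong₂ take (m≤n⇒m⊓n≡m ℓ≤r) (drop-drop q o S) ⟩
    take ℓ (drop (q + o) S)                    ∎
  where open ≡-Reasoning

sub-within : ∀ {σ} (S : Str σ) q o L ℓ → o + ℓ ≤ L → sub (sub S q L) o ℓ ≡ sub S (q + o) ℓ
sub-within S q o L ℓ o+ℓ≤L = begin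
    sub (sub S q L) o ℓ              ≡⟨ cong (λ L → sub (sub S q L) o ℓ) (m+[n∸m]≡n o≤L) ⟨
    sub (sub S q (o + (L ∸ o))) o ℓ  ≡⟨ sub-sub S q o (L ∸ o) ℓ ℓ≤L∸o ⟩
    sub S (q + o) ℓ                  ∎
  where
  open ≡-Reasoning
  o≤L : o ≤ L
  o≤L = m+n≤o⇒m≤o o o+ℓ≤L
  ℓ≤L∸o : ℓ ≤ L ∸ o
  ℓ≤L∸o = m+n≤o⇒m≤o∸n ℓ (subst (_≤ L) (+-comm o ℓ) o+ℓ≤L)

not-T : ∀ {x} → T (not x) → ¬ T x
not-T {false} _ ()

¬T⇒T-not : ∀ {x} → ¬ T x → T (not x)
¬T⇒T-not {false} _ = _
¬T⇒T-not {true} ¬t = ¬t _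

leftmost⇒new : ∀ {σ} (S : Str σ) {p m q} → T (leftmost S p m) → q < p → sub S q m ≢ sub S p m
leftmost⇒new S {p} {m} {q} lm q<p same =
  not-T (All.lookup (All.all⁺ _ (upTo p) lm) (∈-upTo⁺ q<p))
        (fromWitness {a? = ≡-dec Fin._≟_ (sub S q m) (sub S p m)} same)

new⇒leftmost : ∀ {σ} (S : Str σ) {p m} → (∀ {q} → q < p → sub S q m ≢ sub S p m) → T (leftmost S p m)
new⇒leftmost S {p} {m} new = All.all⁻ _ (All.tabulate λ q∈ → ¬T⇒T-not (new (∈-upTo⁻ q∈) ∘ toWitness))

-- A window that contains a leftmost occurrence is itself a leftmost occurrence:
-- an earlier copy of the window would carry an earlier copy of the occurrence.
leftmost-window : ∀ {σ} (S : Str σ) {p ℓ w o L} →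
  T (leftmost S p ℓ) → p ≡ w + o → o + ℓ ≤ L → T (leftmost S w L)
leftmost-window S {p} {ℓ} {w} {o} {L} lm refl o+ℓ≤L = new⇒leftmost S {w} {L} λ {q} q<w same →
  leftmost⇒new S {w + o} {ℓ} lm (+-monoˡ-< o q<w) (begin
    sub S (q + o) ℓ        ≡⟨ sub-within S q o L ℓ o+ℓ≤L ⟨
    sub (sub S q L) o ℓ    ≡⟨ cong (λ u → sub u o ℓ) same ⟩
    sub (sub S w L) o ℓ    ≡⟨ sub-within S w o L ℓ o+ℓ≤L ⟩
    sub S (w + o) ℓ        ∎)
  where open ≡-Reasoning

-- d_k(S) is at least the number of distinct positions holding leftmost occurrences
-- of length-k substrings, since these substrings are pairwise different.
leftmost-≤-dist : ∀ {σ} (S : Str σ) k {ws : List ℕ} → AllPairs _<_ ws →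
  All (λ w → T (leftmost S w k) × w + k ≤ length S) ws → length ws ≤ dist k S
leftmost-≤-dist S k {ws} ws-sorted occ = begin
    length ws                          ≡⟨ length-map (λ w → sub S w k) ws ⟨
    length (map (λ w → sub S w k) ws)  ≤⟨ unique-⊆-length distinct included ⟩
    dist k S                           ∎
  where
  open ≤-Reasoning
  distinct : Unique (map (λ w → sub S w k) ws)
  distinct = AllPairs.map⁺ (AllPairs-upgrade (λ {_} {w} _ (lm , _) v<w → leftmost⇒new S {w} {k} lm v<w) ws-sorted occ)
  included : map (λ w → sub S w k) ws ⊆ _
  included x∈ with ∈-map⁻ _ x∈
  ... | w , w∈ws , refl = ∈-deduplicate⁺ (≡-dec Fin._≟_) (∈-map⁺ _ (∈-upTo⁺ w<))
    where
    w+k≤n : w + k ≤ length S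
    w+k≤n = proj₂ (All.lookup occ w∈ws)
    w< : w < suc (length S) ∸ k
    w< = subst (w <_) (sym (+-∸-assoc 1 (m+n≤o⇒n≤o w w+k≤n)))
               (s≤s (m+n≤o⇒m≤o∸n w w+k≤n))

progression : ℕ → ℕ → ℕ → List ℕ
progression a d c = map (λ i → a + i * d) (upTo c)

progression-length : ∀ a d c → length (progression a d c) ≡ c
progression-length a d c = trans (length-map _ (upTo c)) (length-upTo c)

progression-member : ∀ {a d c x} → x ∈ progression a d c → Σ ℕ λ i → i < c × x ≡ a + i * d
progression-member x∈ with ∈-map⁻ _ x∈
... | i , i∈ , x≡ = i , ∈-upTo⁻ i∈ , x≡

progression-sorted : ∀ a d c .{{_ : NonZero d}} → AllPairs _<_ (progression a d c)
progression-sorted a d c =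
  AllPairs.map⁺ (AllPairs.map (λ i<j → +-monoʳ-< a (*-monoˡ-< d i<j)) (upTo-sorted c))

progression-below : ∀ {a d c x} → x ∈ progression a d c → x + d ≤ a + c * d
progression-below {a} {d} {c} x∈ with progression-member x∈
... | i , i<c , refl = begin
    a + i * d + d    ≡⟨ +-assoc a (i * d) d ⟩
    a + (i * d + d)  ≡⟨ cong (a +_) (+-comm (i * d) d) ⟩
    a + suc i * d    ≤⟨ +-monoʳ-≤ a (*-monoˡ-≤ d i<c) ⟩
    a + c * d        ∎
  where open ≤-Reasoning

progression-separated : ∀ {a d c a' d' c'} .{{_ : NonZero d}} → a + c * d ≤ a' →
  All (λ x → All (x <_) (progression a' d' c')) (progression a d c)
progression-separated {a} {d} {c} {a'} {d'} {c'} gap = All.tabulate λ x∈ → All.tabulate λ y∈ → below x∈ y∈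
  where
  below : ∀ {x y} → x ∈ progression a d c → y ∈ progression a' d' c' → x < y
  below {x} x∈ y∈ with progression-member {a'} {d'} {c'} y∈
  ... | i' , _ , refl = begin-strict
    x             <⟨ m<m+n x (>-nonZero⁻¹ d) ⟩
    x + d         ≤⟨ progression-below x∈ ⟩
    a + c * d     ≤⟨ gap ⟩
    a'            ≤⟨ m≤m+n a' (i' * d') ⟩
    a' + i' * d'  ∎
    where open ≤-Reasoning

length-concatMap : {A B : Set} (f : A → List B) {c : ℕ} → (∀ x → length (f x) ≡ c) →
  (xs : List A) → length (concatMap f xs) ≡ length xs * c
length-concatMap f lf [] = refl
length-concatMap f {c} lf (x ∷ xs) = begin
    length (f x ++ concatMap f xs)            ≡⟨ length-++ (f x) ⟩
    length (f x) + length (concatMap f xs)    ≡⟨ cong₂ _+_ (lf x) (length-concatMap f lf xs) ⟩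
    c + length xs * c                         ∎
  where open ≡-Reasoning

All-concatMap : {A B : Set} {P : A → Set} {Q : B → Set} (f : A → List B) →
  (∀ {x} → P x → All Q (f x)) → {xs : List A} → All P xs → All Q (concatMap f xs)
All-concatMap f PQ Pxs = All.concat⁺ (All.map⁺ (All.map PQ Pxs))

markedTest : ∀ {σ} → Str σ → ℕ → List ℕ → ℕ → Bool
markedTest S b bs p =
  (memᵇ (p + b) bs ∧ leftmost S p (b + b))
  ∨ ((b ≤ᵇ p) ∧ memᵇ (p ∸ b) bs ∧ leftmost S (p ∸ b) (b + b))

∨-∧-last : ∀ a x c d y → T ((a ∧ x) ∨ (c ∧ d ∧ y)) → T x ⊎ T y
∨-∧-last a x c d y t with Equivalence.to (T-∨ {a ∧ x}) t
... | inj₁ ax  = inj₁ (proj₂ (Equivalence.to (T-∧ {a}) ax))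
... | inj₂ cdy = inj₂ (proj₂ (Equivalence.to (T-∧ {d}) (proj₂ (Equivalence.to (T-∧ {c}) cdy))))

marked-occurrence : ∀ {σ} (S : Str σ) b bs p → T (markedTest S b bs p) →
  T (leftmost S p (b + b)) ⊎ T (leftmost S (p ∸ b) (b + b))
marked-occurrence S b bs p = ∨-∧-last (memᵇ (p + b) bs) (leftmost S p (b + b))
  (b ≤ᵇ p) (memᵇ (p ∸ b) bs) (leftmost S (p ∸ b) (b + b))

record Blocks {σ} (S : Str σ) (b : ℕ) (bs : List ℕ) : Set where
  field
    increasing : AllPairs _<_ bs
    aligned    : All (b ∣_) bs
    inside     : All (λ p → p + b ≤ length S) bs

aligned-gap : ∀ {b m m'} .{{_ : NonZero b}} → b ∣ m → b ∣ m' → m < m' → m + b ≤ m'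
aligned-gap {b} (divides i refl) (divides i' refl) m<m' = begin
    i * b + b  ≡⟨ +-comm (i * b) b ⟩
    suc i * b  ≤⟨ *-monoˡ-≤ b (*-cancelʳ-< b i i' m<m') ⟩
    i' * b     ∎
  where open ≤-Reasoning

shift : ∀ e j c → j ≤ c → e + c ≡ (e + j) + (c ∸ j)
shift e j c j≤c = trans (cong (e +_) (sym (m+[n∸m]≡n j≤c))) (sym (+-assoc e j (c ∸ j)))

near-end : ∀ {i M} → suc i ≤ M → M < 3 + i → i ≡ M ∸ 1 ⊎ i ≡ M ∸ 2
near-end i<M M<3+i with m≤n⇒m<n∨m≡n i<M
... | inj₂ refl = inj₁ refl
... | inj₁ i+1<M with ≤-antisym i+1<M (s≤s⁻¹ M<3+i)
...   | refl = inj₂ refl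

module OneLevel {σ} (S : Str σ) (b N : ℕ) .{{_ : NonZero b}} (n≡Nb : length S ≡ N * b) where

  n 2b 3b 4b : ℕ
  n = length S
  2b = b + b
  3b = b + 2b
  4b = 2b + 2b

  interior : ℕ → Bool
  interior m = (2b ≤ᵇ m) ∧ (m + 3b ≤ᵇ n)

  interiorMarked nonInterior : List ℕ → List ℕ
  interiorMarked bs = filterᵇ (λ m → markedTest S b bs m ∧ interior m) bs
  nonInterior bs = filterᵇ (not ∘ interior) bs

  marked-split : ∀ bs → length (marked S b bs) ≤ length (interiorMarked bs) + length (nonInterior bs)
  marked-split bs = length-filterᵇ-split (markedTest S b bs) interior bs

  -- Only the first two and the last two blocks of S can fail to be interior.
  boundaryStarts : List ℕ
  boundaryStarts = 0 ∷ b ∷ (N ∸ 2) * b ∷ (N ∸ 1) * b ∷ []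

  not-interior : ∀ m → T (not (interior m)) → m < 2b ⊎ n < m + 3b
  not-interior m t with 2b ≤? m
  ... | no  2b≰m = inj₁ (≰⇒> 2b≰m)
  ... | yes 2b≤m = inj₂ (≰⇒> λ m+3b≤n → not-T t (Equivalence.from T-∧ (≤⇒≤ᵇ 2b≤m , ≤⇒≤ᵇ m+3b≤n)))

  first-two : ∀ i → i * b < 2b → i * b ∈ boundaryStarts
  first-two i ib<2b with *-cancelʳ-< b i 2 (subst (i * b <_) (cong (b +_) (sym (+-identityʳ b))) ib<2b)
  ... | s≤s z≤n       = here refl
  ... | s≤s (s≤s z≤n) = there (here (*-identityˡ b))

  last-two : ∀ i → i * b + b ≤ n → n < i * b + 3b → i * b ∈ boundaryStarts
  last-two i ib+b≤n n<ib+3b with near-end i<N N<3+i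
    where
    i<N : suc i ≤ N
    i<N = *-cancelʳ-≤ (suc i) N b (subst₂ _≤_ (+-comm (i * b) b) n≡Nb ib+b≤n)
    three : ∀ i b → i * b + (b + (b + b)) ≡ (3 + i) * b
    three = solve-∀
    N<3+i : N < 3 + i
    N<3+i = *-cancelʳ-< b N (3 + i) (subst₂ _<_ n≡Nb (three i b) n<ib+3b)
  ... | inj₁ i≡N-1 = there (there (there (here (cong (_* b) i≡N-1))))
  ... | inj₂ i≡N-2 = there (there (here (cong (_* b) i≡N-2)))

  nonInterior-≤4 : ∀ {bs} → Blocks S b bs → length (nonInterior bs) ≤ 4
  nonInterior-≤4 {bs} blocks =
    unique-⊆-length (AllPairs.map <⇒≢ (AllPairs-filterᵇ (not ∘ interior) increasing)) boundary
    where
    open Blocks blocks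
    boundary : nonInterior bs ⊆ boundaryStarts
    boundary m∈ with ∈-filterᵇ⁻ (not ∘ interior) bs m∈
    ... | m∈bs , t with All.lookup aligned m∈bs | All.lookup inside m∈bs
    ... | divides i refl | ib+b≤n with not-interior (i * b) t
    ...   | inj₁ ib<2b   = first-two i ib<2b
    ...   | inj₂ n<ib+3b = last-two i ib+b≤n n<ib+3b

  record Anchor (m : ℕ) : Set where
    field
      aligned    : b ∣ m
      after-2b   : 2b ≤ m
      before-3b  : m + 3b ≤ n
      occurrence : T (leftmost S m 2b) ⊎ T (leftmost S (m ∸ b) 2b)

  anchors : ∀ {bs} → All (b ∣_) bs → All Anchor (interiorMarked bs)
  anchors {bs} aligned = All.tabulate anchor
    where
    anchor : ∀ {m} → m ∈ interiorMarked bs → Anchor m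
    anchor {m} m∈ with ∈-filterᵇ⁻ _ bs m∈
    ... | m∈bs , t with Equivalence.to (T-∧ {markedTest S b bs m}) t
    ... | isMarked , isInterior with Equivalence.to (T-∧ {2b ≤ᵇ m}) isInterior
    ... | far-start , far-end = record
      { aligned    = All.lookup aligned m∈bs
      ; after-2b   = ≤ᵇ⇒≤ 2b m far-start
      ; before-3b  = ≤ᵇ⇒≤ (m + 3b) n far-end
      ; occurrence = marked-occurrence S b bs m isMarked
      }

  -- The b windows of length 4b starting at m−2b, …, m−b−1 all contain the leftmost
  -- pair occurrence that marked m, so each is a leftmost occurrence as well.
  windows : ℕ → List ℕ
  windows m = progression (m ∸ 2b) 1 b

  window-leftmost : ∀ {m j} → Anchor m → j < b →
    T (leftmost S (m ∸ 2b + j) 4b) × m ∸ 2b + j + 4b ≤ n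
  window-leftmost {m} {j} anchor j<b = leftmost-w occurrence , fits
    where
    open Anchor anchor
    e : ℕ
    e = m ∸ 2b
    m≡e+2b : m ≡ e + 2b
    m≡e+2b = trans (sym (m+[n∸m]≡n after-2b)) (+-comm 2b e)
    leftmost-w : T (leftmost S m 2b) ⊎ T (leftmost S (m ∸ b) 2b) → T (leftmost S (e + j) 4b)
    leftmost-w (inj₁ first) = leftmost-window S {m} {2b} {e + j} {2b ∸ j} {4b} first
      (trans m≡e+2b (shift e j 2b (≤-trans (<⇒≤ j<b) (m≤m+n b b))))
      (+-monoˡ-≤ 2b (m∸n≤m 2b j))
    leftmost-w (inj₂ second) = leftmost-window S {m ∸ b} {2b} {e + j} {b ∸ j} {4b} second
      (trans m∸b≡e+b (shift e j b (<⇒≤ j<b)))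
      (+-monoˡ-≤ 2b (≤-trans (m∸n≤m b j) (m≤m+n b b)))
      where
      m∸b≡e+b : m ∸ b ≡ e + b
      m∸b≡e+b = trans (cong (_∸ b) (trans m≡e+2b (sym (+-assoc e b b)))) (m+n∸n≡m (e + b) b)
    fits : e + j + 4b ≤ n
    fits = begin
      e + j + 4b          ≤⟨ +-monoˡ-≤ 4b (+-monoʳ-≤ e (<⇒≤ j<b)) ⟩
      e + b + 4b          ≡⟨ regroup e b ⟩
      (e + 2b) + 3b       ≡⟨ cong (_+ 3b) m≡e+2b ⟨
      m + 3b              ≤⟨ before-3b ⟩
      n                   ∎
      where
      open ≤-Reasoning
      regroup : ∀ e b → e + b + ((b + b) + (b + b)) ≡ (e + (b + b)) + (b + (b + b))
      regroup = solve-∀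

  windows-leftmost : ∀ {m} → Anchor m → All (λ w → T (leftmost S w 4b) × w + 4b ≤ n) (windows m)
  windows-leftmost {m} anchor = All.tabulate λ w∈ → facts (progression-member w∈)
    where
    facts : ∀ {w} → Σ ℕ (λ j → j < b × w ≡ m ∸ 2b + j * 1) → T (leftmost S w 4b) × w + 4b ≤ n
    facts (j , j<b , refl) rewrite *-identityʳ j = window-leftmost anchor j<b

  windows-separated : ∀ {m m'} → Anchor m → Anchor m' → m < m' →
    All (λ x → All (x <_) (windows m')) (windows m)
  windows-separated {m} {m'} anchor anchor' m<m' = progression-separated gap
    where
    open Anchor anchor using (after-2b)
    gap : m ∸ 2b + b * 1 ≤ m' ∸ 2b
    gap = begin
      m ∸ 2b + b * 1  ≡⟨ cong (m ∸ 2b +_) (*-identityʳ b) ⟩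
      m ∸ 2b + b      ≡⟨ +-∸-comm b after-2b ⟨
      m + b ∸ 2b      ≤⟨ ∸-monoˡ-≤ 2b (aligned-gap (Anchor.aligned anchor) (Anchor.aligned anchor') m<m') ⟩
      m' ∸ 2b         ∎
      where open ≤-Reasoning

  -- Main count: interior marked blocks carry disjoint families of b leftmost
  -- occurrences of length-4b substrings.
  interiorMarked-≤-dist : ∀ {bs} → Blocks S b bs → length (interiorMarked bs) * b ≤ dist 4b S
  interiorMarked-≤-dist {bs} blocks = begin
      length (interiorMarked bs) * b             ≡⟨ length-concatMap windows (λ m → progression-length _ 1 b) (interiorMarked bs) ⟨
      length (concatMap windows (interiorMarked bs)) ≤⟨ leftmost-≤-dist S 4b sorted (All-concatMap windows windows-leftmost anchored) ⟩
      dist 4b S                                  ∎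
    where
    open ≤-Reasoning
    open Blocks blocks
    anchored : All Anchor (interiorMarked bs)
    anchored = anchors aligned
    sorted : AllPairs _<_ (concatMap windows (interiorMarked bs))
    sorted = concatMap-sorted windows (AllPairs-filterᵇ _ increasing) anchored
               (λ _ → progression-sorted _ 1 b) windows-separated

  interiorMarked-room : ∀ {bs} → Blocks S b bs → interiorMarked bs ≡ [] ⊎ 4b ≤ n
  interiorMarked-room {bs} blocks with interiorMarked bs | anchors (Blocks.aligned blocks)
  ... | []    | _ = inj₁ refl
  ... | m ∷ _ | anchor ∷ _ = inj₂ (begin
      2b + 2b        ≤⟨ +-monoʳ-≤ 2b (m≤n+m 2b b) ⟩
      2b + 3b        ≤⟨ +-monoˡ-≤ 3b after-2b ⟩
      m + 3b         ≤⟨ before-3b ⟩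
      n              ∎)
    where
    open ≤-Reasoning
    open Anchor anchor

maxOf : (ℕ → ℕ) → List ℕ → ℕ
maxOf f l = foldr _⊔_ 0 (map f l)

≤-maxOf : ∀ f {l j} → j ∈ l → f j ≤ maxOf f l
≤-maxOf f {x ∷ l} (here refl)  = m≤m⊔n (f x) _
≤-maxOf f {x ∷ l} (there j∈l) = ≤-trans (≤-maxOf f j∈l) (m≤n⊔m (f x) _)

maxOf-attained : ∀ f l → maxOf f l ≡ 0 ⊎ Σ ℕ λ j → j ∈ l × maxOf f l ≡ f j
maxOf-attained f [] = inj₁ refl
maxOf-attained f (x ∷ l) with ≤-total (f x) (maxOf f l)
... | inj₂ fx≥ = inj₂ (x , here refl , m≥n⇒m⊔n≡m fx≥)
... | inj₁ fx≤ with maxOf-attained f l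
...   | inj₁ max≡0 = inj₂ (x , here refl ,
      trans (m≤n⇒m⊔n≡n fx≤) (trans max≡0 (sym (n≤0⇒n≡0 (subst (f x ≤_) max≡0 fx≤)))))
...   | inj₂ (j , j∈l , max≡fj) = inj₂ (j , there j∈l , trans (m≤n⇒m⊔n≡n fx≤) max≡fj)

-- Integer stand-in for 4·δ(S): the largest ⌊4·d_k(S)/k⌋ over k ∈ [1, |S|].
Δ : ∀ {σ} → Str σ → ℕ
Δ S = maxOf (λ j → 4 * dist (suc j) S / suc j) (upTo (length S))

≤-Δ : ∀ {σ} (S : Str σ) {b L} → 1 ≤ b → (b + b) + (b + b) ≤ length S →
  L * b ≤ dist ((b + b) + (b + b)) S → L ≤ Δ S
≤-Δ S {suc b'} {L} _ room count = begin
    L                  ≡⟨ m*n/n≡m L 4b ⟨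
    L * 4b / 4b        ≤⟨ /-monoˡ-≤ 4b (subst (_≤ 4 * dist 4b S) (times4 L (suc b')) (*-monoʳ-≤ 4 count)) ⟩
    4 * dist 4b S / 4b ≤⟨ ≤-maxOf (λ j → 4 * dist (suc j) S / suc j) (∈-upTo⁺ room) ⟩
    Δ S                ∎
  where
  open ≤-Reasoning
  4b : ℕ
  4b = (suc b' + suc b') + (suc b' + suc b')
  times4 : ∀ L b → 4 * (L * b) ≡ L * ((b + b) + (b + b))
  times4 = solve-∀

-- A nonempty string has a length-1 substring, so Δ(S) ≥ 4·d_1(S) ≥ 4.
Δ-≥4 : ∀ {σ} (S : Str σ) → 1 ≤ length S → 4 ≤ Δ S
Δ-≥4 S@(_ ∷ _) n≥1 = begin
    4                  ≤⟨ *-monoʳ-≤ 4 (s≤s z≤n) ⟩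
    4 * dist 1 S       ≡⟨ n/1≡n (4 * dist 1 S) ⟨
    4 * dist 1 S / 1   ≤⟨ ≤-maxOf (λ j → 4 * dist (suc j) S / suc j) (∈-upTo⁺ n≥1) ⟩
    Δ S                ∎
  where open ≤-Reasoning

-- Every level of blocks has at most 2·Δ(S) marked blocks: at most Δ(S) interior ones
-- and at most 4 ≤ Δ(S) near the ends of S.
marked-≤-2Δ : ∀ {σ} (S : Str σ) {b bs} .{{_ : NonZero b}} → 1 ≤ length S → b ∣ length S →
  Blocks S b bs → length (marked S b bs) ≤ 2 * Δ S
marked-≤-2Δ S {b} {bs} n≥1 (divides N n≡Nb) blocks = begin
    length (marked S b bs)                               ≤⟨ marked-split bs ⟩
    length (interiorMarked bs) + length (nonInterior bs) ≤⟨ +-mono-≤ interior≤Δ boundary≤Δ ⟩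
    Δ S + Δ S                                            ≡⟨ cong (Δ S +_) (+-identityʳ (Δ S)) ⟨
    2 * Δ S                                              ∎
  where
  open ≤-Reasoning
  open OneLevel S b N n≡Nb
  interior≤Δ : length (interiorMarked bs) ≤ Δ S
  interior≤Δ with interiorMarked-room blocks
  ... | inj₁ none = subst (λ l → length l ≤ Δ S) (sym none) z≤n
  ... | inj₂ room = ≤-Δ S (>-nonZero⁻¹ b) room (interiorMarked-≤-dist blocks)
  boundary≤Δ : length (nonInterior bs) ≤ Δ S
  boundary≤Δ = ≤-trans (nonInterior-≤4 blocks) (Δ-≥4 S n≥1)

marked-blocks : ∀ {σ} (S : Str σ) {b bs} → Blocks S b bs → Blocks S b (marked S b bs)
marked-blocks S {b} {bs} blocks = record
  { increasing = AllPairs-filterᵇ (markedTest S b bs) increasing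
  ; aligned    = All-filterᵇ (markedTest S b bs) aligned
  ; inside     = All-filterᵇ (markedTest S b bs) inside
  }
  where open Blocks blocks

children-length : ∀ {σ} (S : Str σ) τ k bs →
  length (children S τ k bs) ≡ length (marked S (τ ^ suc k) bs) * τ
children-length S τ k bs =
  length-concatMap (λ p → progression p (τ ^ k) τ) (λ p → progression-length p (τ ^ k) τ) (marked S (τ ^ suc k) bs)

children-blocks : ∀ {σ} (S : Str σ) τ .{{_ : NonZero τ}} k {bs} →
  Blocks S (τ ^ suc k) bs → Blocks S (τ ^ k) (children S τ k bs)
children-blocks S τ k blocks = record
  { increasing = concatMap-sorted subBlocks increasing aligned (λ _ → progression-sorted _ (τ ^ k) τ)
                   (λ p∣ p'∣ p<p' → progression-separated (aligned-gap p∣ p'∣ p<p'))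
  ; aligned    = All-concatMap subBlocks (λ p∣ → All.tabulate λ x∈ → sub-aligned p∣ (progression-member x∈)) aligned
  ; inside     = All-concatMap subBlocks (λ p-inside → All.tabulate λ x∈ → ≤-trans (progression-below x∈) p-inside) inside
  }
  where
  instance
    τ^k≢0 : NonZero (τ ^ k)
    τ^k≢0 = m^n≢0 τ k
    τ^1+k≢0 : NonZero (τ ^ suc k)
    τ^1+k≢0 = m^n≢0 τ (suc k)
  open Blocks (marked-blocks S blocks)
  subBlocks : ℕ → List ℕ
  subBlocks p = progression p (τ ^ k) τ
  sub-aligned : ∀ {p x} → τ ^ suc k ∣ p → Σ ℕ (λ i → i < τ × x ≡ p + i * τ ^ k) → τ ^ k ∣ x
  sub-aligned p∣ (i , _ , refl) = ∣m∣n⇒∣m+n (∣-trans (n∣m*n τ) p∣) (n∣m*n i)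

levels-size : ∀ {σ} (S : Str σ) τ (Inv : ℕ → List ℕ → Set) (X : ℕ) →
  (∀ {k bs} → Inv (suc k) bs → Inv k (children S τ k bs)) →
  (∀ {k bs} → Inv (suc k) bs → length (children S τ k bs) ≤ X) →
  ∀ k bs → Inv k bs → Counts.size (levels S τ k bs) ≤ length bs + Counts.height (levels S τ k bs) * X
levels-size S τ Inv X inherit few k [] _ = z≤n
levels-size S τ Inv X inherit few zero (_ ∷ _) _ = m≤m+n _ _
levels-size {σ} S τ Inv X inherit few (suc k) bs@(_ ∷ _) inv with isLeafLevel σ (length S) τ (suc k)
... | true  = m≤m+n _ _
... | false = +-monoʳ-≤ (length bs) (begin
    Counts.size below                     ≤⟨ levels-size S τ Inv X inherit few k next (inherit inv) ⟩
    length next + Counts.height below * X ≤⟨ +-monoˡ-≤ (Counts.height below * X) (few inv) ⟩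
    X + Counts.height below * X           ∎)
  where
  open ≤-Reasoning
  next : List ℕ
  next = children S τ k bs
  below : Counts
  below = levels S τ k next

levels-height : ∀ {σ} (S : Str σ) τ L →
  (∀ K → isLeafLevel σ (length S) τ (suc K) ≡ false → L ≤ suc K) →
  ∀ k bs → Counts.height (levels S τ k bs) ≤ (suc k ∸ L) + 1
levels-height S τ L deep k [] = z≤n
levels-height S τ L deep zero (_ ∷ _) = m≤n+m 1 _
levels-height {σ} S τ L deep (suc k) bs@(_ ∷ _) with isLeafLevel σ (length S) τ (suc k) in leaf
... | true  = m≤n+m 1 _
... | false = begin
    suc (Counts.height (levels S τ k (children S τ k bs))) ≤⟨ s≤s (levels-height S τ L deep k (children S τ k bs)) ⟩
    suc ((suc k ∸ L) + 1)                                  ≡⟨ cong (_+ 1) (+-∸-assoc 1 (deep k leaf)) ⟨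
    (suc (suc k) ∸ L) + 1                                  ∎
  where open ≤-Reasoning

-- m ≤ 2^⌈log₂ m⌉, by the recursion defining ⌈log₂⌉: m ≤ 2·(1 + ⌈(m−2)/2⌉) for m ≥ 2.
≤-2^⌈log2⌉ : ∀ m (rec : Acc _<_ m) → m ≤ 2 ^ ⌈log2⌉ m rec
≤-2^⌈log2⌉ zero _ = z≤n
≤-2^⌈log2⌉ (suc zero) _ = s≤s z≤n
≤-2^⌈log2⌉ (suc (suc m)) (acc rs) = ≤-trans halve (*-monoʳ-≤ 2 (≤-2^⌈log2⌉ (suc ⌈ m /2⌉) _))
  where
  halve : suc (suc m) ≤ 2 * suc ⌈ m /2⌉
  halve = begin
    suc (suc m)                    ≡⟨ cong (suc ∘ suc) (⌊n/2⌋+⌈n/2⌉≡n m) ⟨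
    suc (suc (⌊ m /2⌋ + ⌈ m /2⌉))  ≤⟨ s≤s (s≤s (+-monoˡ-≤ ⌈ m /2⌉ (⌊n/2⌋≤⌈n/2⌉ m))) ⟩
    suc (suc (⌈ m /2⌉ + ⌈ m /2⌉))  ≡⟨ double ⌈ m /2⌉ ⟩
    2 * suc ⌈ m /2⌉                ∎
    where
    open ≤-Reasoning
    double : ∀ h → suc (suc (h + h)) ≡ 2 * suc h
    double = solve-∀

≤-2^⌈log₂⌉ : ∀ m → m ≤ 2 ^ ⌈log₂ m ⌉
≤-2^⌈log₂⌉ m = ≤-2^⌈log2⌉ m (<-wellFounded m)

<-^ : ∀ τ → 2 ≤ τ → ∀ m → m < τ ^ m
<-^ τ τ≥2 zero = s≤s z≤n
<-^ τ τ≥2 (suc m) = begin-strict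
    suc m            <⟨ s≤s (<-^ τ τ≥2 m) ⟩
    suc (τ ^ m)      ≤⟨ +-monoˡ-≤ (τ ^ m) (≤-trans (s≤s z≤n) (<-^ τ τ≥2 m)) ⟩
    τ ^ m + τ ^ m    ≡⟨ cong (τ ^ m +_) (+-identityʳ (τ ^ m)) ⟨
    2 * τ ^ m        ≤⟨ *-monoˡ-≤ (τ ^ m) τ≥2 ⟩
    τ ^ suc m        ∎
  where open ≤-Reasoning

logSearch-sound : ∀ a c τ f j₀ → a ≤ τ ^ (j₀ + f) * c → a ≤ τ ^ logSearch a c τ f j₀ * c
logSearch-sound a c τ zero j₀ met = subst (λ e → a ≤ τ ^ e * c) (+-identityʳ j₀) met
logSearch-sound a c τ (suc f) j₀ met with a ≤ᵇ τ ^ j₀ * c in found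
... | true  = ≤ᵇ⇒≤ a (τ ^ j₀ * c) (subst T (sym found) _)
... | false = logSearch-sound a c τ f (suc j₀) (subst (λ e → a ≤ τ ^ e * c) (+-suc j₀ f) met)

base-≥2 : ∀ {σ m x} → 2 ≤ m → m ≤ σ ^ x → 2 ≤ σ
base-≥2 {σ} {m} {x} m≥2 m≤σ^x = ≮⇒≥ λ σ<2 → <⇒≱ m≥2 (begin
    m          ≤⟨ m≤σ^x ⟩
    σ ^ x      ≤⟨ ^-monoˡ-≤ x (s≤s⁻¹ σ<2) ⟩
    1 ^ x      ≡⟨ ^-zeroˡ x ⟩
    1          ∎)
  where open ≤-Reasoning

log-≤ : ∀ {σ m x} → 2 ≤ σ → 1 ≤ x → m ≤ σ ^ x → ⌈log₂ m ⌉ ⊔ 1 ≤ ⌈log₂ σ ⌉ * x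
log-≤ {σ} {m} {x} σ≥2 x≥1 m≤σ^x = ⊔-lub (begin
    ⌈log₂ m ⌉                        ≤⟨ ⌈log₂⌉-mono-≤ (≤-trans m≤σ^x (^-monoˡ-≤ x (≤-2^⌈log₂⌉ σ))) ⟩
    ⌈log₂ ((2 ^ ⌈log₂ σ ⌉) ^ x) ⌉    ≡⟨ cong ⌈log₂_⌉ (^-*-assoc 2 ⌈log₂ σ ⌉ x) ⟩
    ⌈log₂ (2 ^ (⌈log₂ σ ⌉ * x)) ⌉    ≡⟨ ⌈log₂2^n⌉≡n (⌈log₂ σ ⌉ * x) ⟩
    ⌈log₂ σ ⌉ * x                    ∎)
  (*-mono-≤ (⌈log₂⌉-mono-≤ σ≥2) x≥1)
  where open ≤-Reasoning

module LeafDepth (σ τ s t n : ℕ) (τ≥2 : 2 ≤ τ) (s≥1 : 1 ≤ s) (n≡ : n ≡ s * τ ^ t) where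

  instance
    τ≢0 : NonZero τ
    τ≢0 = >-nonZero (≤-trans (s≤s z≤n) τ≥2)
    s≢0 : NonZero s
    s≢0 = >-nonZero s≥1

  g ln j : ℕ
  g = ⌈log₂ σ ⌉
  ln = ⌈log₂ n ⌉ ⊔ 1
  j = logSearch (n * g) (s * ln) τ (suc (n * g)) 0

  -- n·⌈log₂ σ⌉ ≤ τ^j · s · ⌈log₂ n⌉, as the search has enough fuel.
  search-bound : n * g ≤ τ ^ j * (s * ln)
  search-bound = logSearch-sound (n * g) (s * ln) τ (suc (n * g)) 0 (begin
    n * g                      ≤⟨ <⇒≤ (<-^ τ τ≥2 (n * g)) ⟩
    τ ^ (n * g)                ≤⟨ ^-monoʳ-≤ τ (n≤1+n (n * g)) ⟩
    τ ^ suc (n * g)            ≡⟨ *-identityʳ _ ⟨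
    τ ^ suc (n * g) * 1        ≤⟨ *-monoʳ-≤ (τ ^ suc (n * g)) (*-mono-≤ s≥1 (m≤n⊔m ⌈log₂ n ⌉ 1)) ⟩
    τ ^ suc (n * g) * (s * ln) ∎)
    where open ≤-Reasoning

  n≥2 : 1 ≤ t → 2 ≤ n
  n≥2 t≥1 = begin
    2          ≤⟨ τ≥2 ⟩
    τ          ≡⟨ *-identityʳ τ ⟨
    τ ^ 1      ≤⟨ ^-monoʳ-≤ τ t≥1 ⟩
    τ ^ t      ≤⟨ m≤n*m (τ ^ t) s ⟩
    s * τ ^ t  ≡⟨ n≡ ⟨
    n          ∎
    where open ≤-Reasoning

  -- If σ^(τ^K) ≥ n then log n ≤ τ^K·log σ, so s·τ^t·log σ ≤ τ^(j+K)·s·log σ and t ≤ j + K.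
  deep-levels : ∀ K → n ≤ σ ^ (τ ^ K) → t ≤ j + K
  deep-levels K n≤σ^x = ≮⇒≥ λ j+K<t → <⇒≱ (^-monoʳ-< τ τ≥2 j+K<t) (τ^t≤ (n≥2 (≤-trans (s≤s z≤n) j+K<t)))
    where
    x : ℕ
    x = τ ^ K
    τ^t≤ : 2 ≤ n → τ ^ t ≤ τ ^ (j + K)
    τ^t≤ 2≤n = *-cancelʳ-≤ (τ ^ t) (τ ^ (j + K)) g {{>-nonZero g≥1}} (*-cancelˡ-≤ s (begin
      s * (τ ^ t * g)         ≡⟨ *-assoc s (τ ^ t) g ⟨
      s * τ ^ t * g           ≡⟨ cong (_* g) n≡ ⟨
      n * g                   ≤⟨ search-bound ⟩
      τ ^ j * (s * ln)        ≤⟨ *-monoʳ-≤ (τ ^ j) (*-monoʳ-≤ s (log-≤ {x = x} σ≥2 (m^n>0 τ K) n≤σ^x)) ⟩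
      τ ^ j * (s * (g * x))   ≡⟨ regroup (τ ^ j) s g x ⟩
      s * (τ ^ j * x * g)     ≡⟨ cong (λ y → s * (y * g)) (^-distribˡ-+-* τ j K) ⟨
      s * (τ ^ (j + K) * g)   ∎))
      where
      open ≤-Reasoning
      regroup : ∀ y s g x → y * (s * (g * x)) ≡ s * (y * x * g)
      regroup = solve-∀
      σ≥2 : 2 ≤ σ
      σ≥2 = base-≥2 {x = x} 2≤n n≤σ^x
      g≥1 : 1 ≤ g
      g≥1 = ⌈log₂⌉-mono-≤ σ≥2

  -- The hypothesis of levels-height, with L = t − j.
  non-leaf-deep : ∀ K → isLeafLevel σ n τ (suc K) ≡ false → t ∸ j ≤ suc K
  non-leaf-deep K not-leaf = m≤n+o⇒m∸n≤o t j (deep-levels (suc K) (≮⇒≥ λ lt →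
    subst T not-leaf (<⇒<ᵇ lt)))

module RationalBounds where

  open import Data.Integer using (+_)

  toℚᵘ-ℕtoℚ : ∀ m → toℚᵘ (ℕtoℚ m) U.≃ mkℚᵘ (+ m) 0
  toℚᵘ-ℕtoℚ m = Qₚ.toℚᵘ-fromℚᵘ (mkℚᵘ (+ m) 0)

  toℚᵘ-ratio : ∀ D j → toℚᵘ (+ D Q./ suc j) U.≃ mkℚᵘ (+ D) j
  toℚᵘ-ratio D j = Qₚ.toℚᵘ-fromℚᵘ (mkℚᵘ (+ D) j)

  bound : ℕ → ℕ → ℕ → ℕ → ℕ → ℕ → ℚ
  bound c s D j τ L = ℕtoℚ c Q.* (ℕtoℚ s Q.+ (+ D Q./ suc j) Q.* ℕtoℚ τ Q.* ℕtoℚ L)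

  boundᵘ : ℕ → ℕ → ℕ → ℕ → ℕ → ℕ → ℚᵘ
  boundᵘ c s D j τ L = mkℚᵘ (+ c) 0 U.* (mkℚᵘ (+ s) 0 U.+ mkℚᵘ (+ D) j U.* mkℚᵘ (+ τ) 0 U.* mkℚᵘ (+ L) 0)

  toℚᵘ-bound : ∀ c s D j τ L → toℚᵘ (bound c s D j τ L) U.≃ boundᵘ c s D j τ L
  toℚᵘ-bound c s D j τ L =
    Uₚ.≃-trans (Qₚ.toℚᵘ-homo-* (ℕtoℚ c) _) (Uₚ.*-cong (toℚᵘ-ℕtoℚ c)
    (Uₚ.≃-trans (Qₚ.toℚᵘ-homo-+ (ℕtoℚ s) _) (Uₚ.+-cong (toℚᵘ-ℕtoℚ s)
    (Uₚ.≃-trans (Qₚ.toℚᵘ-homo-* ((+ D Q./ suc j) Q.* ℕtoℚ τ) (ℕtoℚ L)) (Uₚ.*-cong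
    (Uₚ.≃-trans (Qₚ.toℚᵘ-homo-* (+ D Q./ suc j) (ℕtoℚ τ)) (Uₚ.*-cong (toℚᵘ-ratio D j) (toℚᵘ-ℕtoℚ τ)))
    (toℚᵘ-ℕtoℚ L))))))

  numerator : ∀ c s D k τ L →
    (+ c ℤ.* (+ s ℤ.* + k ℤ.+ (+ D ℤ.* + τ ℤ.* + L) ℤ.* + 1)) ℤ.* + 1 ≡ + (c * (s * k + D * τ * L))
  numerator c s D k τ L = begin
    (+ c ℤ.* (+ s ℤ.* + k ℤ.+ (+ D ℤ.* + τ ℤ.* + L) ℤ.* + 1)) ℤ.* + 1
      ≡⟨ ℤₚ.*-identityʳ _ ⟩
    + c ℤ.* (+ s ℤ.* + k ℤ.+ (+ D ℤ.* + τ ℤ.* + L) ℤ.* + 1)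
      ≡⟨ cong (λ z → + c ℤ.* (+ s ℤ.* + k ℤ.+ z)) (ℤₚ.*-identityʳ _) ⟩
    + c ℤ.* (+ s ℤ.* + k ℤ.+ + D ℤ.* + τ ℤ.* + L)
      ≡⟨ cong (λ z → + c ℤ.* (+ s ℤ.* + k ℤ.+ z ℤ.* + L)) (ℤₚ.pos-* D τ) ⟨
    + c ℤ.* (+ s ℤ.* + k ℤ.+ + (D * τ) ℤ.* + L)
      ≡⟨ cong₂ (λ x y → + c ℤ.* (x ℤ.+ y)) (ℤₚ.pos-* s k) (ℤₚ.pos-* (D * τ) L) ⟨
    + c ℤ.* (+ (s * k) ℤ.+ + (D * τ * L))
      ≡⟨ cong (+ c ℤ.*_) (ℤₚ.pos-+ (s * k) (D * τ * L)) ⟨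
    + c ℤ.* + (s * k + D * τ * L)
      ≡⟨ ℤₚ.pos-* c (s * k + D * τ * L) ⟨
    + (c * (s * k + D * τ * L))
      ∎
    where open ≡-Reasoning

  clear-denominator : ∀ c a s D j τ L → a * suc j ≤ c * (s * suc j + D * τ * L) →
    ℕtoℚ a Q.≤ bound c s D j τ L
  clear-denominator c a s D j τ L h = Qₚ.toℚᵘ-cancel-≤
    (Uₚ.≤-respˡ-≃ (Uₚ.≃-sym (toℚᵘ-ℕtoℚ a)) (Uₚ.≤-respʳ-≃ (Uₚ.≃-sym (toℚᵘ-bound c s D j τ L)) cross-multiplied))
    where
    -- the denominator of boundᵘ, as computed by ℚᵘ multiplication
    k : ℕ
    k = suc (j * 1 * 1)
    k≡ : suc j ≡ k
    k≡ = cong suc (sym (trans (*-identityʳ (j * 1)) (*-identityʳ j)))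
    h' : a * k ≤ c * (s * k + D * τ * L)
    h' = subst (λ m → a * m ≤ c * (s * m + D * τ * L)) k≡ h
    lhs : + (a * k) ≡ + a ℤ.* + (1 * (1 * k))
    lhs = trans (cong (λ m → + (a * m)) (sym (trans (*-identityˡ (1 * k)) (*-identityˡ k)))) (ℤₚ.pos-* a (1 * (1 * k)))
    cross-multiplied : mkℚᵘ (+ a) 0 U.≤ boundᵘ c s D j τ L
    cross-multiplied = U.*≤* (subst₂ ℤ._≤_ lhs (sym (numerator c s D k τ L)) (ℤ.+≤+ h'))

  ratio-≤-δ : ∀ {σ} (S : Str σ) {j} → j < length S → + dist (suc j) S Q./ suc j Q.≤ δ S
  ratio-≤-δ S j<n = ≤-foldr-⊔ (λ j → + dist (suc j) S Q./ suc j) (∈-upTo⁺ j<n)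
    where
    ≤-foldr-⊔ : (g : ℕ → ℚ) {l : List ℕ} {j : ℕ} → j ∈ l → g j Q.≤ foldr Q._⊔_ Q.0ℚ (map g l)
    ≤-foldr-⊔ g {x ∷ l} (here refl)  = Qₚ.p≤p⊔q (g x) _
    ≤-foldr-⊔ g {x ∷ l} (there j∈l) = Qₚ.≤-trans (≤-foldr-⊔ g j∈l) (Qₚ.p≤q⊔p (g x) _)

  ℕtoℚ-nonNeg : ∀ m → Q.NonNegative (ℕtoℚ m)
  ℕtoℚ-nonNeg m = Qₚ.normalize-nonNeg m 1

  bound-mono : ∀ c s τ L {q q'} → q Q.≤ q' →
    ℕtoℚ c Q.* (ℕtoℚ s Q.+ q Q.* ℕtoℚ τ Q.* ℕtoℚ L) Q.≤ ℕtoℚ c Q.* (ℕtoℚ s Q.+ q' Q.* ℕtoℚ τ Q.* ℕtoℚ L)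
  bound-mono c s τ L q≤q' =
    Qₚ.*-monoˡ-≤-nonNeg (ℕtoℚ c) {{ℕtoℚ-nonNeg c}} (Qₚ.+-monoʳ-≤ (ℕtoℚ s)
      (Qₚ.*-monoʳ-≤-nonNeg (ℕtoℚ L) {{ℕtoℚ-nonNeg L}} (Qₚ.*-monoʳ-≤-nonNeg (ℕtoℚ τ) {{ℕtoℚ-nonNeg τ}} q≤q')))

  -- Δ(S) = ⌊4·d_k(S)/k⌋ for some k ≤ |S|, so Δ(S) ≤ 4·δ(S): an integer bound in terms of
  -- Δ(S) becomes the rational bound in terms of δ(S).
  Δ-to-δ : ∀ {σ} (S : Str σ) a s τ L → 1 ≤ length S → a ≤ s + 2 * L * (2 * Δ S * τ) →
    ℕtoℚ a Q.≤ ℕtoℚ 16 Q.* (ℕtoℚ s Q.+ δ S Q.* ℕtoℚ τ Q.* ℕtoℚ L)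
  Δ-to-δ S a s τ L n≥1 a≤ with maxOf-attained (λ j → 4 * dist (suc j) S / suc j) (upTo (length S))
  ... | inj₁ Δ≡0 = ⊥-elim (<⇒≱ (subst (3 <_) Δ≡0 (Δ-≥4 S n≥1)) z≤n)
  ... | inj₂ (j , j∈ , Δ≡) = Qₚ.≤-trans (clear-denominator 16 a s D j τ L cleared)
                                         (bound-mono 16 s τ L (ratio-≤-δ S (∈-upTo⁻ j∈)))
    where
    D k : ℕ
    D = dist (suc j) S
    k = suc j
    Δk≤4D : Δ S * k ≤ 4 * D
    Δk≤4D = subst (λ x → x * k ≤ 4 * D) (sym Δ≡) (m/n*n≤m (4 * D) k)
    cleared : a * k ≤ 16 * (s * k + D * τ * L)
    cleared = begin
      a * k                                ≤⟨ *-monoˡ-≤ k a≤ ⟩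
      (s + 2 * L * (2 * Δ S * τ)) * k      ≡⟨ expand s L (Δ S) τ k ⟩
      s * k + 4 * (L * τ) * (Δ S * k)      ≤⟨ +-mono-≤ (m≤n*m (s * k) 16) (*-monoʳ-≤ (4 * (L * τ)) Δk≤4D) ⟩
      16 * (s * k) + 4 * (L * τ) * (4 * D) ≡⟨ collect s k D τ L ⟩
      16 * (s * k + D * τ * L)             ∎
      where
      open ≤-Reasoning
      expand : ∀ s L Δ τ k → (s + 2 * L * (2 * Δ * τ)) * k ≡ s * k + 4 * (L * τ) * (Δ * k)
      expand = solve-∀
      collect : ∀ s k D τ L → 16 * (s * k) + 4 * (L * τ) * (4 * D) ≡ 16 * (s * k + D * τ * L)
      collect = solve-∀

open RationalBounds using (Δ-to-δ)

module BlockTree {σ} (S : Str σ) (τ s t : ℕ) (τ≥2 : τ ≥ 2) (s≥1 : s ≥ 1) (n≡ : length S ≡ s * τ ^ t) where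

  instance
    τ≢0 : NonZero τ
    τ≢0 = >-nonZero (≤-trans (s≤s z≤n) τ≥2)

  open LeafDepth σ τ s t (length S) τ≥2 s≥1 n≡ using (j; non-leaf-deep)

  L : ℕ
  L = logTerm (length S) σ s τ

  n≥1 : 1 ≤ length S
  n≥1 = subst (1 ≤_) (sym n≡) (*-mono-≤ s≥1 (m^n>0 τ t))

  record Level (k : ℕ) (bs : List ℕ) : Set where
    constructor level
    field
      divides-length : τ ^ k ∣ length S
      blocks         : Blocks S (τ ^ k) bs

  rootStarts : List ℕ
  rootStarts = progression 0 (τ ^ t) s

  root : Level t rootStarts
  root = level (subst (τ ^ t ∣_) (sym n≡) (n∣m*n s)) record
    { increasing = progression-sorted 0 (τ ^ t) s {{m^n≢0 τ t}}
    ; aligned    = All.tabulate λ x∈ → root-aligned (progression-member x∈)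
    ; inside     = All.tabulate λ x∈ → subst (_ ≤_) (sym n≡) (progression-below x∈)
    }
    where
    root-aligned : ∀ {x} → Σ ℕ (λ i → i < s × x ≡ 0 + i * τ ^ t) → τ ^ t ∣ x
    root-aligned (i , _ , refl) = n∣m*n i

  next-level : ∀ {k bs} → Level (suc k) bs → Level k (children S τ k bs)
  next-level {k} (level τ^1+k∣n blocks) = level (∣-trans (n∣m*n τ {τ ^ k}) τ^1+k∣n) (children-blocks S τ k blocks)

  few-children : ∀ {k bs} → Level (suc k) bs → length (children S τ k bs) ≤ 2 * Δ S * τ
  few-children {k} {bs} (level τ^1+k∣n blocks) = begin
    length (children S τ k bs)            ≡⟨ children-length S τ k bs ⟩
    length (marked S (τ ^ suc k) bs) * τ  ≤⟨ *-monoˡ-≤ τ (marked-≤-2Δ S {{m^n≢0 τ (suc k)}} n≥1 τ^1+k∣n blocks) ⟩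
    2 * Δ S * τ                           ∎
    where open ≤-Reasoning

  -- Height: the levels below exponent t − j are leaves, so there are at most j + 2 levels.
  height-bound : btHeight S τ s t ≤ 2 * L
  height-bound = begin
    btHeight S τ s t         ≤⟨ levels-height S τ (t ∸ j) non-leaf-deep t rootStarts ⟩
    (suc t ∸ (t ∸ j)) + 1    ≤⟨ +-monoˡ-≤ 1 (m≤n+o⇒m∸n≤o (suc t) (t ∸ j) t≤) ⟩
    suc j + 1                ≤⟨ +-monoʳ-≤ (suc j) (s≤s z≤n) ⟩
    suc j + suc j            ≡⟨ cong (suc j +_) (+-identityʳ (suc j)) ⟨
    2 * L                    ∎
    where
    open ≤-Reasoning
    t≤ : suc t ≤ t ∸ j + suc j
    t≤ = subst (suc t ≤_) (sym (+-suc (t ∸ j) j)) (s≤s (subst (t ≤_) (+-comm j (t ∸ j)) (m≤n+m∸n t j)))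

  size-bound : btSize S τ s t ≤ s + 2 * L * (2 * Δ S * τ)
  size-bound = begin
    btSize S τ s t                                    ≤⟨ levels-size S τ Level (2 * Δ S * τ) next-level few-children t rootStarts root ⟩
    length rootStarts + btHeight S τ s t * (2 * Δ S * τ)
                                                      ≤⟨ +-mono-≤ (≤-reflexive (progression-length 0 (τ ^ t) s))
                                                                  (*-monoˡ-≤ (2 * Δ S * τ) height-bound) ⟩
    s + 2 * L * (2 * Δ S * τ)                         ∎
    where open ≤-Reasoning

theorem7 : Σ ℕ λ C → ∀ (σ τ s t : ℕ) (S : Str σ) → τ ≥ 2 → s ≥ 1 → length S ≡ s * τ ^ t →
    (ℕtoℚ (btSize S τ s t) Q.≤ ℕtoℚ C Q.* (ℕtoℚ s Q.+ δ S Q.* ℕtoℚ τ Q.* ℕtoℚ (logTerm (length S) σ s τ)))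
    × (btHeight S τ s t ≤ C * logTerm (length S) σ s τ)
theorem7 = 16 , λ σ τ s t S τ≥2 s≥1 n≡ →
  let open BlockTree S τ s t τ≥2 s≥1 n≡ in
  Δ-to-δ S (btSize S τ s t) s τ L n≥1 size-bound ,
  ≤-trans height-bound (*-monoˡ-≤ L {2} {16} (s≤s (s≤s z≤n)))
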